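{- Let $h(x)$ be a polynomial with real coefficients and let $F_{h,n}^l(x)=\sum_{i=0}^{l}\binom{n-1-i}{i}h^{n-2i-1}(x)$ for integers $n\ge 1$ and $0\le l\le\lfloor (n-1)/2\rfloor$. Then for all integers $n\ge 2$ and $l$ with $0\le l\le \frac{n-2}{2}$, $$F_{h,n+2}^{l+1}(x)=h(x)F_{h,n+1}^{l+1}(x)+F_{h,n}^{l}(x).$$ Moreover, for all integers $n\ge 1$ and $0\le l\le \lfloor (n-1)/2\rfloor$, the non-homogeneous recurrence $$F_{h,n+2}^{l}(x)=h(x)F_{h,n+1}^{l}(x)+F_{h,n}^{l}(x)-\binom{n-1-l}{l}h^{n-1-2l}(x)$$ holds.
   Context: $h(x)$ is a polynomial with real coefficients; $h^k(x)$ denotes the $k$-th power $(h(x))^k$. The polynomials $F_{h,n}^l(x)$ are called incomplete $h(x)$-Fibonacci polynomials. -}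

module Defs where

open import Level using (Level)
open import Algebra.Bundles using (CommutativeRing; Semiring)
open import Data.Nat using (ℕ; zero; suc; _∸_; _*_)
open import Data.Nat.Combinatorics using (_C_)
import Algebra.Definitions.RawSemiring as RS

-- Incomplete h-Fibonacci polynomials, stated generically: h is an
-- element of an arbitrary commutative ring R (e.g. R = ℝ[x]).
-- F R h n l = Σ_{i=0}^{l} C(n-1-i, i) · h^(n-2i-1)
-- (natural-number truncated subtraction is harmless in the paper's
-- range 0 ≤ l ≤ ⌊(n-1)/2⌋).
module _ {c ℓ : Level} (R : CommutativeRing c ℓ) where
  open CommutativeRing R using (Carrier; _+_; semiring)
  open RS (Semiring.rawSemiring semiring) using (_×_; _^_)

  scal : ℕ → Carrier → Carrier
  scal n x = n × x

  pow : Carrier → ℕ → Carrier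
  pow x k = x ^ k

  fibTerm : Carrier → ℕ → ℕ → Carrier
  fibTerm h n i = ((n ∸ 1 ∸ i) C i) × (h ^ (n ∸ 2 * i ∸ 1))

  F : Carrier → ℕ → ℕ → Carrier
  F h n zero = fibTerm h n zero
  F h n (suc l) = F h n l + fibTerm h n (suc l)

{-# OPTIONS --safe #-}
-- Write f(n, i) = C(n-1-i, i) h^(n-1-2i) for the summands of F.  Pascal's rule
-- C(a+1, i+1) = C(a, i+1) + C(a, i) gives f(n+2, i+1) = h f(n+1, i+1) + f(n, i), and
-- f(n+2, 0) = h f(n+1, 0).  Summing over i ≤ l yields
-- F(n+2, l) + f(n, l) = h F(n+1, l) + F(n, l): the shifted sum Σ_{i<l} f(n, i) falls one
-- summand short of F(n, l).  Cancelling f(n, l+1) from the instance at l+1 gives the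
-- homogeneous recurrence; moving f(n, l) across gives the inhomogeneous one.
module Submission where

open import Defs
open import Level using (Level)
open import Algebra.Bundles using (CommutativeRing; Semiring)
open import Data.Nat using (ℕ; _+_; _*_; _≤_; _∸_)
open import Data.Nat.Combinatorics using (_C_)
open import Data.Product using (_×_)

open import Data.Nat using (zero; suc; s≤s)
import Data.Nat.Properties as ℕₚ
open import Data.Nat.Combinatorics using (nCk+nC[k+1]≡[n+1]C[k+1])
open import Data.Product using (_,_)
open import Relation.Binary.PropositionalEquality as ≡ using (_≡_; cong; cong₂)
import Algebra.Definitions.RawSemiring as RawSemiringDefs
import Algebra.Properties.CommutativeSemigroup as CommutativeSemigroupProperties
import Algebra.Properties.Group as GroupProperties
import Algebra.Properties.Monoid.Mult as MonoidMultProperties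
import Algebra.Properties.Semiring.Mult as SemiringMultProperties
import Relation.Binary.Reasoning.Setoid as SetoidReasoning

∸-suc : ∀ {m n} → suc n ≤ m → m ∸ n ≡ suc (m ∸ suc n)
∸-suc {suc m} (s≤s n≤m) = ℕₚ.+-∸-assoc 1 n≤m

∸-∸-comm : ∀ m n o → m ∸ n ∸ o ≡ m ∸ o ∸ n
∸-∸-comm m n o = begin
  m ∸ n ∸ o    ≡⟨ ℕₚ.∸-+-assoc m n o ⟩
  m ∸ (n + o)  ≡⟨ cong (m ∸_) (ℕₚ.+-comm n o) ⟩
  m ∸ (o + n)  ≡⟨ ℕₚ.∸-+-assoc m o n ⟨
  m ∸ o ∸ n    ∎
  where open ≡.≡-Reasoning

2*[1+n]≡2+2*n : ∀ n → 2 * suc n ≡ suc (suc (2 * n))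
2*[1+n]≡2+2*n = ℕₚ.*-suc 2

module IncompleteFibonacci {c ℓ : Level} (R : CommutativeRing c ℓ) (h : CommutativeRing.Carrier R) where
  open CommutativeRing R renaming (_+_ to _⊕_; _*_ to _⊗_)
  open RawSemiringDefs (Semiring.rawSemiring semiring) using (_^_) renaming (_×_ to _·_)
  open CommutativeSemigroupProperties +-commutativeSemigroup using (interchange)
  open GroupProperties +-group using (∙-cancelʳ; //-rightDividesʳ)
  open MonoidMultProperties +-monoid using (×-homo-+; ×-congˡ)
  open SemiringMultProperties semiring using (×-comm-*)
  open SetoidReasoning setoid

  binomTerm : ℕ → ℕ → ℕ → Carrier
  binomTerm a i e = (a C i) · (h ^ e)

  binomTerm-pascal : ∀ a i e →
    binomTerm (suc a) (suc i) (suc e) ≈ h ⊗ binomTerm a (suc i) e ⊕ binomTerm a i (suc e)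
  binomTerm-pascal a i e = begin
    (suc a C suc i) · (h ⊗ h ^ e)                      ≈⟨ ×-congˡ (≡.sym (nCk+nC[k+1]≡[n+1]C[k+1] a i)) ⟩
    (a C i + a C suc i) · (h ⊗ h ^ e)                  ≈⟨ ×-homo-+ _ (a C i) (a C suc i) ⟩
    binomTerm a i (suc e) ⊕ (a C suc i) · (h ⊗ h ^ e)  ≈⟨ +-comm _ _ ⟩
    (a C suc i) · (h ⊗ h ^ e) ⊕ binomTerm a i (suc e)  ≈⟨ +-congʳ (×-comm-* (a C suc i) h (h ^ e)) ⟨
    h ⊗ binomTerm a (suc i) e ⊕ binomTerm a i (suc e)  ∎

  fibTerm≡binomTerm : ∀ n i → fibTerm R h n i ≡ binomTerm (n ∸ 1 ∸ i) i (n ∸ 1 ∸ 2 * i)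
  fibTerm≡binomTerm n i = cong (binomTerm (n ∸ 1 ∸ i) i) (∸-∸-comm n (2 * i) 1)

  fibTerm-normal : ∀ n i → fibTerm R h n i ≡ binomTerm (n ∸ suc i) i (n ∸ suc (2 * i))
  fibTerm-normal n i =
    ≡.trans (fibTerm≡binomTerm n i)
      (cong₂ (λ a e → binomTerm a i e) (ℕₚ.∸-+-assoc n 1 i) (ℕₚ.∸-+-assoc n 1 (2 * i)))

  fibTerm-pascal : ∀ n i → 2 * suc i ≤ n →
    fibTerm R h (suc (suc n)) (suc i) ≈ h ⊗ fibTerm R h (suc n) (suc i) ⊕ fibTerm R h n i
  fibTerm-pascal n i 2[1+i]≤n = begin
    fibTerm R h (suc (suc n)) (suc i)                   ≡⟨ outer ⟩
    binomTerm (suc q) (suc i) (suc r)                   ≈⟨ binomTerm-pascal q i r ⟩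
    h ⊗ binomTerm q (suc i) r ⊕ binomTerm q i (suc r)   ≡⟨ cong₂ (λ x y → h ⊗ x ⊕ y) middle inner ⟨
    h ⊗ fibTerm R h (suc n) (suc i) ⊕ fibTerm R h n i   ∎
    where
    q r : ℕ
    q = n ∸ suc i
    r = n ∸ suc (suc (2 * i))
    2+2i≤n : suc (suc (2 * i)) ≤ n
    2+2i≤n = ℕₚ.≤-trans (ℕₚ.≤-reflexive (≡.sym (2*[1+n]≡2+2*n i))) 2[1+i]≤n
    1+i≤n : suc i ≤ n
    1+i≤n = ℕₚ.≤-trans (s≤s (ℕₚ.m≤m+n i (suc (i + 0)))) 2[1+i]≤n
    outer : fibTerm R h (suc (suc n)) (suc i) ≡ binomTerm (suc q) (suc i) (suc r)
    outer = ≡.trans (fibTerm-normal (suc (suc n)) (suc i))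
      (cong₂ (λ a e → binomTerm a (suc i) e) (∸-suc 1+i≤n)
        (≡.trans (cong (suc n ∸_) (2*[1+n]≡2+2*n i)) (∸-suc 2+2i≤n)))
    middle : fibTerm R h (suc n) (suc i) ≡ binomTerm q (suc i) r
    middle = ≡.trans (fibTerm-normal (suc n) (suc i))
      (cong (λ k → binomTerm q (suc i) (n ∸ k)) (2*[1+n]≡2+2*n i))
    inner : fibTerm R h n i ≡ binomTerm q i (suc r)
    inner = ≡.trans (fibTerm-normal n i) (cong (binomTerm q i) (∸-suc 2+2i≤n))

  -- Both binomial coefficients compute to 1.
  fibTerm-shift₀ : ∀ n → fibTerm R h (suc (suc n)) 0 ≈ h ⊗ fibTerm R h (suc n) 0
  fibTerm-shift₀ n = sym (×-comm-* 1 h (h ^ n))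

  F+fibTerm-recurrence : ∀ n l → 2 * l ≤ n →
    F R h (suc (suc n)) l ⊕ fibTerm R h n l ≈ h ⊗ F R h (suc n) l ⊕ F R h n l
  F+fibTerm-recurrence n zero _ = +-congʳ (fibTerm-shift₀ n)
  F+fibTerm-recurrence n (suc l) 2[1+l]≤n = begin
    (F R h (suc (suc n)) l ⊕ fibTerm R h (suc (suc n)) (suc l)) ⊕ t
      ≈⟨ +-congʳ (+-congˡ (fibTerm-pascal n l 2[1+l]≤n)) ⟩
    (F R h (suc (suc n)) l ⊕ (h ⊗ a ⊕ fibTerm R h n l)) ⊕ t
      ≈⟨ +-congʳ (+-congˡ (+-comm _ _)) ⟩
    (F R h (suc (suc n)) l ⊕ (fibTerm R h n l ⊕ h ⊗ a)) ⊕ t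
      ≈⟨ +-congʳ (+-assoc _ _ _) ⟨
    ((F R h (suc (suc n)) l ⊕ fibTerm R h n l) ⊕ h ⊗ a) ⊕ t
      ≈⟨ +-congʳ (+-congʳ (F+fibTerm-recurrence n l 2l≤n)) ⟩
    ((h ⊗ F R h (suc n) l ⊕ F R h n l) ⊕ h ⊗ a) ⊕ t
      ≈⟨ +-assoc _ _ _ ⟩
    (h ⊗ F R h (suc n) l ⊕ F R h n l) ⊕ (h ⊗ a ⊕ t)
      ≈⟨ interchange _ _ _ _ ⟩
    (h ⊗ F R h (suc n) l ⊕ h ⊗ a) ⊕ (F R h n l ⊕ t)
      ≈⟨ +-congʳ (distribˡ h _ _) ⟨
    h ⊗ F R h (suc n) (suc l) ⊕ F R h n (suc l) ∎
    where
    a t : Carrier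
    a = fibTerm R h (suc n) (suc l)
    t = fibTerm R h n (suc l)
    2l≤n : 2 * l ≤ n
    2l≤n = ℕₚ.≤-trans (ℕₚ.*-monoʳ-≤ 2 (ℕₚ.n≤1+n l)) 2[1+l]≤n

  F-recurrence : ∀ n l → 2 * suc l ≤ n →
    F R h (suc (suc n)) (suc l) ≈ h ⊗ F R h (suc n) (suc l) ⊕ F R h n l
  F-recurrence n l 2[1+l]≤n = ∙-cancelʳ (fibTerm R h n (suc l)) _ _
    (trans (F+fibTerm-recurrence n (suc l) 2[1+l]≤n) (sym (+-assoc _ _ _)))

  F-inhomogeneous-recurrence : ∀ n l → 2 * l ≤ n →
    F R h (suc (suc n)) l ≈ (h ⊗ F R h (suc n) l ⊕ F R h n l) - fibTerm R h n l
  F-inhomogeneous-recurrence n l 2l≤n = begin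
    F R h (suc (suc n)) l
      ≈⟨ //-rightDividesʳ (fibTerm R h n l) _ ⟨
    (F R h (suc (suc n)) l ⊕ fibTerm R h n l) - fibTerm R h n l
      ≈⟨ +-congʳ (F+fibTerm-recurrence n l 2l≤n) ⟩
    (h ⊗ F R h (suc n) l ⊕ F R h n l) - fibTerm R h n l ∎

proposition2 : {c ℓ : Level} (R : CommutativeRing c ℓ) (h : CommutativeRing.Carrier R) →
    ((n l : ℕ) → 2 ≤ n → 2 * l + 2 ≤ n →
      CommutativeRing._≈_ R (F R h (n + 2) (l + 1))
        (CommutativeRing._+_ R (CommutativeRing._*_ R h (F R h (n + 1) (l + 1))) (F R h n l)))
    × ((n l : ℕ) → 1 ≤ n → 2 * l + 1 ≤ n →
      CommutativeRing._≈_ R (F R h (n + 2) l)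
        (CommutativeRing._-_ R
          (CommutativeRing._+_ R (CommutativeRing._*_ R h (F R h (n + 1) l)) (F R h n l))
          (scal R ((n ∸ 1 ∸ l) C l) (pow R h (n ∸ 1 ∸ 2 * l)))))
proposition2 R h = homogeneous , inhomogeneous
  where
  open CommutativeRing R renaming (_+_ to _⊕_; _*_ to _⊗_)
  open IncompleteFibonacci R h
  open SetoidReasoning setoid

  homogeneous : ∀ n l → 2 ≤ n → 2 * l + 2 ≤ n →
    F R h (n + 2) (l + 1) ≈ h ⊗ F R h (n + 1) (l + 1) ⊕ F R h n l
  homogeneous n l _ 2l+2≤n = begin
    F R h (n + 2) (l + 1)
      ≡⟨ cong₂ (F R h) (ℕₚ.+-comm n 2) (ℕₚ.+-comm l 1) ⟩
    F R h (suc (suc n)) (suc l)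
      ≈⟨ F-recurrence n l 2[1+l]≤n ⟩
    h ⊗ F R h (suc n) (suc l) ⊕ F R h n l
      ≡⟨ cong₂ (λ m k → h ⊗ F R h m k ⊕ F R h n l) (ℕₚ.+-comm 1 n) (ℕₚ.+-comm 1 l) ⟩
    h ⊗ F R h (n + 1) (l + 1) ⊕ F R h n l ∎
    where
    2[1+l]≤n : 2 * suc l ≤ n
    2[1+l]≤n = ℕₚ.≤-trans (ℕₚ.≤-reflexive (≡.trans (2*[1+n]≡2+2*n l) (ℕₚ.+-comm 2 (2 * l)))) 2l+2≤n

  inhomogeneous : ∀ n l → 1 ≤ n → 2 * l + 1 ≤ n →
    F R h (n + 2) l ≈ (h ⊗ F R h (n + 1) l ⊕ F R h n l) - scal R ((n ∸ 1 ∸ l) C l) (pow R h (n ∸ 1 ∸ 2 * l))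
  inhomogeneous n l _ 2l+1≤n = begin
    F R h (n + 2) l
      ≡⟨ cong (λ m → F R h m l) (ℕₚ.+-comm n 2) ⟩
    F R h (suc (suc n)) l
      ≈⟨ F-inhomogeneous-recurrence n l 2l≤n ⟩
    (h ⊗ F R h (suc n) l ⊕ F R h n l) - fibTerm R h n l
      ≡⟨ cong₂ (λ m t → (h ⊗ F R h m l ⊕ F R h n l) - t) (ℕₚ.+-comm 1 n) (fibTerm≡binomTerm n l) ⟩
    (h ⊗ F R h (n + 1) l ⊕ F R h n l) - scal R ((n ∸ 1 ∸ l) C l) (pow R h (n ∸ 1 ∸ 2 * l)) ∎
    where
    2l≤n : 2 * l ≤ n
    2l≤n = ℕₚ.≤-trans (ℕₚ.m≤m+n (2 * l) 1) 2l+1≤n
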